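{- On any LTS $(\mathbb P,Act,\rightarrow)$, the relation $\simeq_{rbr}$ and, for every $X\subseteq A$, the relation $\simeq^X_{rbr}$ are equivalence relations on $\mathbb P$.
   Context: An LTS is $(\mathbb{P},Act,\rightarrow)$ with ${\rightarrow}\subseteq\mathbb{P}\times Act\times\mathbb{P}$, $Act=A\uplus\{\tau,t\}$ ($A$ visible actions, $\tau$ hidden, $t$ time-out). $A_\tau:=A\cup\{\tau\}$. $P\xrightarrow{(\alpha)}P'$ means ($\alpha=\tau$ and $P=P'$) or $P\xrightarrow{\alpha}P'$. $\Longrightarrow$ is the reflexive-transitive closure of $\xrightarrow{\tau}$. $P\not\xrightarrow{\tau}$: $P$ has no $\tau$-transition. $\mathcal I(P):=\{\alpha\in A_\tau\mid\exists Q.\,P\xrightarrow{\alpha}Q\}$. A concrete branching reactive bisimulation is a relation $\mathcal{R}\subseteq(\mathbb{P}\times\mathbb{P})\cup(\mathbb{P}\times\mathcal{P}(A)\times\mathbb{P})$, symmetric ($\mathcal R(P,Q)\Leftrightarrow\mathcal R(Q,P)$, $\mathcal R(P,X,Q)\Leftrightarrow\mathcal R(Q,X,P)$), such that for all $P,Q,X$: 1. if $\mathcal R(P,Q)$: (a) if $P\xrightarrow{\alpha}P'$, $\alpha\in A_\tau$, there is $Q\Longrightarrow Q_1\xrightarrow{(\alpha)}Q_2$ with $\mathcal R(P,Q_1)$, $\mathcal R(P',Q_2)$; (b) $\mathcal R(P,Y,Q)$ for all $Y\subseteq A$; 2. if $\mathcal R(P,X,Q)$: (a) if $P\xrightarrow{\tau}P'$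 there is $Q\Longrightarrow Q_1\xrightarrow{(\tau)}Q_2$ with $\mathcal R(P,X,Q_1)$, $\mathcal R(P',X,Q_2)$; (b) if $P\xrightarrow{a}P'$, $a\in X$, there is $Q\Longrightarrow Q_1\xrightarrow{a}Q_2$ with $\mathcal R(P,X,Q_1)$, $\mathcal R(P',Q_2)$; (c) if $\mathcal I(P)\cap(X\cup\{\tau\})=\emptyset$ there is $Q\Longrightarrow Q_0$ with $\mathcal R(P,Q_0)$; (d) if $\mathcal I(P)\cap(X\cup\{\tau\})=\emptyset$ and $P\xrightarrow{t}P'$ there is $Q\Longrightarrow Q_1\xrightarrow{t}Q_2$ with $\mathcal R(P',X,Q_2)$; (e) if $P\not\xrightarrow{\tau}$ there is $Q\Longrightarrow Q_0$ with $Q_0\not\xrightarrow{\tau}$. $P\simeq_{br}Q$ (resp. $P\simeq^X_{br}Q$) iff $\mathcal R(P,Q)$ (resp. $\mathcal R(P,X,Q)$) for some such $\mathcal R$. A rooted concrete branching reactive bisimulation is a symmetric relation of the same type with: 1. if $\mathcal R(P,Q)$: (a) if $P\xrightarrow{\alpha}P'$, $\alpha\in A_\tau$, then $Q\xrightarrow{\alpha}Q'$ for some $Q'$ with $P'\simeq_{br}Q'$; (b) $\mathcal R(P,Y,Q)$ for all $Y\subseteq A$; 2. if $\mathcal R(P,X,Q)$: (a) if $P\xrightarrow{\tau}P'$ then $Q\xrightarrow{\tau}Q'$ with $P'\simeq^X_{br}Q'$; (b) if $P\xrightarrow{a}P'$, $a\in X$, then $Q\xrightarrow{a}Q'$ with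 $P'\simeq_{br}Q'$; (c) if $\mathcal I(P)\cap(X\cup\{\tau\})=\emptyset$ then $\mathcal R(P,Q)$; (d) if $\mathcal I(P)\cap(X\cup\{\tau\})=\emptyset$ and $P\xrightarrow{t}P'$ then $Q\xrightarrow{t}Q'$ with $P'\simeq^X_{br}Q'$. $P\simeq_{rbr}Q$ (resp. $P\simeq^X_{rbr}Q$) iff $\mathcal R(P,Q)$ (resp. $\mathcal R(P,X,Q)$) for some such $\mathcal R$. -}

module Defs where

open import Level using (Level; _⊔_) renaming (suc to lsuc; zero to lzero)
open import Data.Product using (Σ; ∃; ∃₂; _×_; _,_)
open import Data.Sum using (_⊎_)
open import Data.Unit using (⊤)
open import Data.Empty using (⊥)
open import Relation.Nullary using (¬_)
open import Relation.Binary.PropositionalEquality using (_≡_)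
open import Relation.Binary.Construct.Closure.ReflexiveTransitive using (Star)

data Act (A : Set) : Set where
  act : A → Act A
  τ   : Act A
  t   : Act A

InAτ : {A : Set} → Act A → Set
InAτ (act _) = ⊤
InAτ τ       = ⊤
InAτ t       = ⊥

record LTS : Set₁ where
  field
    Proc  : Set
    A     : Set
    _⟶[_]_ : Proc → Act A → Proc → Set

module _ (L : LTS) where
  open LTS L

  Subset : Set₁
  Subset = A → Set

  OptStep : Proc → Act A → Proc → Set
  OptStep P α P' = (α ≡ τ × P ≡ P') ⊎ (P ⟶[ α ] P')

  TauSteps : Proc → Proc → Set
  TauSteps = Star (λ P P' → P ⟶[ τ ] P')

  NoTau : Proc → Set
  NoTau P = ∀ P' → ¬ (P ⟶[ τ ] P')

  Idle : Subset → Proc → Set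
  Idle X P = (∀ a → X a → ∀ P' → ¬ (P ⟶[ act a ] P')) × NoTau P

  record IsCBRB (R : Proc → Proc → Set) (RX : Proc → Subset → Proc → Set) : Set₁ where
    field
      symR  : ∀ {P Q} → R P Q → R Q P
      symRX : ∀ {P X Q} → RX P X Q → RX Q X P
      c1a : ∀ {P Q α P'} → R P Q → InAτ α → P ⟶[ α ] P' →
            ∃₂ λ Q₁ Q₂ → TauSteps Q Q₁ × OptStep Q₁ α Q₂ × R P Q₁ × R P' Q₂
      c1b : ∀ {P Q} → R P Q → ∀ (Y : Subset) → RX P Y Q
      c2a : ∀ {P X Q P'} → RX P X Q → P ⟶[ τ ] P' →
            ∃₂ λ Q₁ Q₂ → TauSteps Q Q₁ × OptStep Q₁ τ Q₂ × RX P X Q₁ × RX P' X Q₂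
      c2b : ∀ {P X Q a P'} → RX P X Q → X a → P ⟶[ act a ] P' →
            ∃₂ λ Q₁ Q₂ → TauSteps Q Q₁ × Q₁ ⟶[ act a ] Q₂ × RX P X Q₁ × R P' Q₂
      c2c : ∀ {P X Q} → RX P X Q → Idle X P →
            ∃ λ Q₀ → TauSteps Q Q₀ × R P Q₀
      c2d : ∀ {P X Q P'} → RX P X Q → Idle X P → P ⟶[ t ] P' →
            ∃₂ λ Q₁ Q₂ → TauSteps Q Q₁ × Q₁ ⟶[ t ] Q₂ × RX P' X Q₂
      c2e : ∀ {P X Q} → RX P X Q → NoTau P →
            ∃ λ Q₀ → TauSteps Q Q₀ × NoTau Q₀

  BrEq : Proc → Proc → Set₁
  BrEq P Q = Σ (Proc → Proc → Set) λ R → Σ (Proc → Subset → Proc → Set) λ RX →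
             IsCBRB R RX × R P Q

  BrEqX : Subset → Proc → Proc → Set₁
  BrEqX X P Q = Σ (Proc → Proc → Set) λ R → Σ (Proc → Subset → Proc → Set) λ RX →
                IsCBRB R RX × RX P X Q

  record IsRCBRB (R : Proc → Proc → Set) (RX : Proc → Subset → Proc → Set) : Set₁ where
    field
      symR  : ∀ {P Q} → R P Q → R Q P
      symRX : ∀ {P X Q} → RX P X Q → RX Q X P
      r1a : ∀ {P Q α P'} → R P Q → InAτ α → P ⟶[ α ] P' →
            ∃ λ Q' → Q ⟶[ α ] Q' × BrEq P' Q'
      r1b : ∀ {P Q} → R P Q → ∀ (Y : Subset) → RX P Y Q
      r2a : ∀ {P X Q P'} → RX P X Q → P ⟶[ τ ] P' →
            ∃ λ Q' → Q ⟶[ τ ] Q' × BrEqX X P' Q'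
      r2b : ∀ {P X Q a P'} → RX P X Q → X a → P ⟶[ act a ] P' →
            ∃ λ Q' → Q ⟶[ act a ] Q' × BrEq P' Q'
      r2c : ∀ {P X Q} → RX P X Q → Idle X P → R P Q
      r2d : ∀ {P X Q P'} → RX P X Q → Idle X P → P ⟶[ t ] P' →
            ∃ λ Q' → Q ⟶[ t ] Q' × BrEqX X P' Q'

  RBrEq : Proc → Proc → Set₁
  RBrEq P Q = Σ (Proc → Proc → Set) λ R → Σ (Proc → Subset → Proc → Set) λ RX →
              IsRCBRB R RX × R P Q

  RBrEqX : Subset → Proc → Proc → Set₁
  RBrEqX X P Q = Σ (Proc → Proc → Set) λ R → Σ (Proc → Subset → Proc → Set) λ RX →
                 IsRCBRB R RX × RX P X Q

-- For transitivity, the composite R₁ ⨾ R₂ of two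
-- bisimulations, symmetrised to R₁ ⨾ R₂ ∪ R₂ ⨾ R₁, is again a bisimulation.
-- In the rooted case this only needs transitivity of the unrooted ≃_br and
-- ≃^X_br for the continuations.  In the unrooted case the second relation
-- follows the first along the τ-path it answers with, and clauses 2(c)-(e)
-- rest on the observation that a state related to a stable (resp. idle)
-- state P reaches by τ-steps a stable (resp. idle) state related to P itself.
module Submission where

open import Defs
open import Data.Product using (_×_; ∃; ∃₂; _,_; proj₁; proj₂)
open import Data.Sum using (inj₁; inj₂)
open import Data.Unit using (tt)
open import Data.Empty using (⊥-elim)
open import Relation.Nullary using (¬_)
open import Relation.Binary.Core using (_⇒_)
open import Relation.Binary.PropositionalEquality using (_≡_; refl; sym)
open import Relation.Binary.Construct.Closure.ReflexiveTransitive using (ε; _◅_; _◅◅_)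
open import Relation.Binary.Construct.Union using (_∪_)
open import Relation.Binary.Structures using (IsEquivalence)

module _ (L : LTS) where
  open LTS L

  BRel : Set₁
  BRel = Proc → Proc → Set

  XRel : Set₁
  XRel = Proc → Subset L → Proc → Set

  _at_ : XRel → Subset L → BRel
  (RX at X) P Q = RX P X Q

  infixr 9 _⨾_ _⨾ˣ_
  infixr 6 _∪ˣ_

  _⨾_ : BRel → BRel → BRel
  (R ⨾ S) P U = ∃ λ Q → R P Q × S Q U

  _⨾ˣ_ : XRel → XRel → XRel
  (RX ⨾ˣ SX) P X = (RX at X ⨾ SX at X) P

  _∪ˣ_ : XRel → XRel → XRel
  (RX ∪ˣ SX) P X = (RX at X ∪ SX at X) P

  ⨾-∪-symmetric : ∀ {R₁ R₂ : BRel} →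
                  (∀ {P Q} → R₁ P Q → R₁ Q P) → (∀ {P Q} → R₂ P Q → R₂ Q P) →
                  ∀ {P Q} → (R₁ ⨾ R₂ ∪ R₂ ⨾ R₁) P Q → (R₁ ⨾ R₂ ∪ R₂ ⨾ R₁) Q P
  ⨾-∪-symmetric sym₁ sym₂ (inj₁ (Q , r₁ , r₂)) = inj₂ (Q , sym₂ r₂ , sym₁ r₁)
  ⨾-∪-symmetric sym₁ sym₂ (inj₂ (Q , r₂ , r₁)) = inj₁ (Q , sym₁ r₁ , sym₂ r₂)

  optτ⇒τ* : ∀ {P P'} → OptStep L P τ P' → TauSteps L P P'
  optτ⇒τ* (inj₁ (refl , refl)) = ε
  optτ⇒τ* (inj₂ step)          = step ◅ ε

  stable-τ*⇒≡ : ∀ {P P'} → NoTau L P → TauSteps L P P' → P ≡ P'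
  stable-τ*⇒≡ stable ε          = refl
  stable-τ*⇒≡ stable (step ◅ _) = ⊥-elim (stable _ step)

  module CBRB {R : BRel} {RX : XRel} (isB : IsCBRB L R RX) where
    open IsCBRB isB

    τ*-transfer : ∀ {P Q P₁} → R P Q → TauSteps L P P₁ →
                  ∃ λ Q₁ → TauSteps L Q Q₁ × R P₁ Q₁
    τ*-transfer r ε = _ , ε , r
    τ*-transfer r (step ◅ path) with c1a r tt step
    ... | _ , _ , pre , opt , _ , r' with τ*-transfer r' path
    ... | Q₁ , post , r₁ = Q₁ , pre ◅◅ optτ⇒τ* opt ◅◅ post , r₁

    τ*-transferˣ : ∀ {P X Q P₁} → RX P X Q → TauSteps L P P₁ →
                   ∃ λ Q₁ → TauSteps L Q Q₁ × RX P₁ X Q₁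
    τ*-transferˣ r ε = _ , ε , r
    τ*-transferˣ r (step ◅ path) with c2a r step
    ... | _ , _ , pre , opt , _ , r' with τ*-transferˣ r' path
    ... | Q₁ , post , r₁ = Q₁ , pre ◅◅ optτ⇒τ* opt ◅◅ post , r₁

    -- Clause 2(e) gives some stable Q', and following Q ⟹ Q' back from the
    -- stable P can only stay at P, so Q' is related to P itself.
    stable-match : ∀ {P X Q} → RX P X Q → NoTau L P →
                   ∃ λ Q' → TauSteps L Q Q' × NoTau L Q' × RX Q' X P
    stable-match r stable with c2e r stable
    ... | Q' , path , stable' with τ*-transferˣ (symRX r) path
    ... | _ , back , r' with stable-τ*⇒≡ stable back
    ... | refl = Q' , path , stable' , r'

    idle-match : ∀ {P X Q} → RX P X Q → Idle L X P →
                 ∃ λ Q' → TauSteps L Q Q' × R P Q' × Idle L X Q'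
    idle-match {P} {X} r (noX , stable) with stable-match r stable
    ... | Q' , path , stable' , r' = Q' , path , related , idle'
      where
        idle' : Idle L X Q'
        idle' = noX' , stable'
          where
            noX' : ∀ a → X a → ∀ Q'' → ¬ Q' ⟶[ act a ] Q''
            noX' a a∈X _ step with c2b r' a∈X step
            ... | _ , P₂ , path , answer , _ with stable-τ*⇒≡ stable path
            ... | refl = noX a a∈X P₂ answer

        related : R P Q'
        related with c2c r' idle'
        ... | _ , path , r₀ with stable-τ*⇒≡ stable path
        ... | refl = symR r₀

  module CBRB-⨾ {R₁ R₂ : BRel} {RX₁ RX₂ : XRel}
                (isB₁ : IsCBRB L R₁ RX₁) (isB₂ : IsCBRB L R₂ RX₂)
                {T : BRel} {TX : XRel}
                (ι : R₁ ⨾ R₂ ⇒ T) (ιˣ : ∀ {X} → (RX₁ at X ⨾ RX₂ at X) ⇒ TX at X) where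
    module B₁ = IsCBRB isB₁
    module B₂ = IsCBRB isB₂
    open CBRB isB₁ using (idle-match; stable-match)
    open CBRB isB₂ using (τ*-transfer; τ*-transferˣ)

    c1a : ∀ {P Q S α P'} → R₁ P Q → R₂ Q S → InAτ α → P ⟶[ α ] P' →
          ∃₂ λ S₁ S₂ → TauSteps L S S₁ × OptStep L S₁ α S₂ × T P S₁ × T P' S₂
    c1a r₁ r₂ α∈Aτ step with B₁.c1a r₁ α∈Aτ step
    ... | _ , _ , path , opt , r₁ᵃ , r₁ᵇ with τ*-transfer r₂ path
    c1a r₁ r₂ α∈Aτ step | _ , _ , _ , inj₁ (refl , refl) , r₁ᵃ , r₁ᵇ | S' , path' , r₂' =
      S' , S' , path' , inj₁ (refl , refl) , ι (_ , r₁ᵃ , r₂') , ι (_ , r₁ᵇ , r₂')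
    c1a r₁ r₂ α∈Aτ step | _ , _ , _ , inj₂ answer , r₁ᵃ , r₁ᵇ | S' , path' , r₂'
      with B₂.c1a r₂' α∈Aτ answer
    ... | S₁ , S₂ , path'' , opt , r₂ᵃ , r₂ᵇ =
      S₁ , S₂ , path' ◅◅ path'' , opt , ι (_ , r₁ᵃ , r₂ᵃ) , ι (_ , r₁ᵇ , r₂ᵇ)

    c1b : ∀ {P Q S} → R₁ P Q → R₂ Q S → ∀ Y → TX P Y S
    c1b r₁ r₂ Y = ιˣ (_ , B₁.c1b r₁ Y , B₂.c1b r₂ Y)

    c2a : ∀ {P X Q S P'} → RX₁ P X Q → RX₂ Q X S → P ⟶[ τ ] P' →
          ∃₂ λ S₁ S₂ → TauSteps L S S₁ × OptStep L S₁ τ S₂ × TX P X S₁ × TX P' X S₂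
    c2a r₁ r₂ step with B₁.c2a r₁ step
    ... | _ , _ , path , opt , r₁ᵃ , r₁ᵇ with τ*-transferˣ r₂ path
    c2a r₁ r₂ step | _ , _ , _ , inj₁ (refl , refl) , r₁ᵃ , r₁ᵇ | S' , path' , r₂' =
      S' , S' , path' , inj₁ (refl , refl) , ιˣ (_ , r₁ᵃ , r₂') , ιˣ (_ , r₁ᵇ , r₂')
    c2a r₁ r₂ step | _ , _ , _ , inj₂ answer , r₁ᵃ , r₁ᵇ | S' , path' , r₂'
      with B₂.c2a r₂' answer
    ... | S₁ , S₂ , path'' , opt , r₂ᵃ , r₂ᵇ =
      S₁ , S₂ , path' ◅◅ path'' , opt , ιˣ (_ , r₁ᵃ , r₂ᵃ) , ιˣ (_ , r₁ᵇ , r₂ᵇ)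

    c2b : ∀ {P X Q S a P'} → RX₁ P X Q → RX₂ Q X S → X a → P ⟶[ act a ] P' →
          ∃₂ λ S₁ S₂ → TauSteps L S S₁ × S₁ ⟶[ act a ] S₂ × TX P X S₁ × T P' S₂
    c2b r₁ r₂ a∈X step with B₁.c2b r₁ a∈X step
    ... | _ , _ , path , answer , r₁ᵃ , r₁ᵇ with τ*-transferˣ r₂ path
    ... | _ , path' , r₂' with B₂.c2b r₂' a∈X answer
    ... | S₁ , S₂ , path'' , answer' , r₂ᵃ , r₂ᵇ =
      S₁ , S₂ , path' ◅◅ path'' , answer' , ιˣ (_ , r₁ᵃ , r₂ᵃ) , ι (_ , r₁ᵇ , r₂ᵇ)

    c2c : ∀ {P X Q S} → RX₁ P X Q → RX₂ Q X S → Idle L X P →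
          ∃ λ S₀ → TauSteps L S S₀ × T P S₀
    c2c r₁ r₂ idle with idle-match r₁ idle
    ... | _ , path , r₁' , idle' with τ*-transferˣ r₂ path
    ... | _ , path' , r₂' with B₂.c2c r₂' idle'
    ... | S₀ , path'' , r₂'' = S₀ , path' ◅◅ path'' , ι (_ , r₁' , r₂'')

    -- The time-out of P is matched by B₁ from the idle Q' rather than from Q,
    -- so that B₂ can answer it from an idle state as well.
    c2d : ∀ {P X Q S P'} → RX₁ P X Q → RX₂ Q X S → Idle L X P → P ⟶[ t ] P' →
          ∃₂ λ S₁ S₂ → TauSteps L S S₁ × S₁ ⟶[ t ] S₂ × TX P' X S₂
    c2d {X = X} r₁ r₂ idle step with idle-match r₁ idle
    ... | _ , path , r₁' , idle'@(_ , stable') with B₁.c2d (B₁.c1b r₁' X) idle step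
    ... | _ , _ , path₁ , timeout , r₁'' with stable-τ*⇒≡ stable' path₁
    ... | refl with τ*-transferˣ r₂ path
    ... | _ , path' , r₂' with B₂.c2d r₂' idle' timeout
    ... | S₁ , S₂ , path'' , timeout' , r₂'' =
      S₁ , S₂ , path' ◅◅ path'' , timeout' , ιˣ (_ , r₁'' , r₂'')

    c2e : ∀ {P X Q S} → RX₁ P X Q → RX₂ Q X S → NoTau L P →
          ∃ λ S₀ → TauSteps L S S₀ × NoTau L S₀
    c2e r₁ r₂ stable with stable-match r₁ stable
    ... | _ , path , stable' , _ with τ*-transferˣ r₂ path
    ... | _ , path' , r₂' with B₂.c2e r₂' stable'
    ... | S₀ , path'' , stable'' = S₀ , path' ◅◅ path'' , stable''

  ⨾-∪-isCBRB : ∀ {R₁ R₂ RX₁ RX₂} → IsCBRB L R₁ RX₁ → IsCBRB L R₂ RX₂ →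
               IsCBRB L (R₁ ⨾ R₂ ∪ R₂ ⨾ R₁) (RX₁ ⨾ˣ RX₂ ∪ˣ RX₂ ⨾ˣ RX₁)
  ⨾-∪-isCBRB {R₁} {R₂} {RX₁} {RX₂} isB₁ isB₂ = record
    { symR  = ⨾-∪-symmetric {R₁} {R₂} (IsCBRB.symR isB₁) (IsCBRB.symR isB₂)
    ; symRX = λ {_} {X} → ⨾-∪-symmetric {RX₁ at X} {RX₂ at X} (IsCBRB.symRX isB₁) (IsCBRB.symRX isB₂)
    ; c1a = λ { (inj₁ (_ , r₁ , r₂)) → K₁₂.c1a r₁ r₂ ; (inj₂ (_ , r₂ , r₁)) → K₂₁.c1a r₂ r₁ }
    ; c1b = λ { (inj₁ (_ , r₁ , r₂)) → K₁₂.c1b r₁ r₂ ; (inj₂ (_ , r₂ , r₁)) → K₂₁.c1b r₂ r₁ }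
    ; c2a = λ { (inj₁ (_ , r₁ , r₂)) → K₁₂.c2a r₁ r₂ ; (inj₂ (_ , r₂ , r₁)) → K₂₁.c2a r₂ r₁ }
    ; c2b = λ { (inj₁ (_ , r₁ , r₂)) → K₁₂.c2b r₁ r₂ ; (inj₂ (_ , r₂ , r₁)) → K₂₁.c2b r₂ r₁ }
    ; c2c = λ { (inj₁ (_ , r₁ , r₂)) → K₁₂.c2c r₁ r₂ ; (inj₂ (_ , r₂ , r₁)) → K₂₁.c2c r₂ r₁ }
    ; c2d = λ { (inj₁ (_ , r₁ , r₂)) → K₁₂.c2d r₁ r₂ ; (inj₂ (_ , r₂ , r₁)) → K₂₁.c2d r₂ r₁ }
    ; c2e = λ { (inj₁ (_ , r₁ , r₂)) → K₁₂.c2e r₁ r₂ ; (inj₂ (_ , r₂ , r₁)) → K₂₁.c2e r₂ r₁ }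
    }
    where
      module K₁₂ = CBRB-⨾ isB₁ isB₂ inj₁ inj₁
      module K₂₁ = CBRB-⨾ isB₂ isB₁ inj₂ inj₂

  ≡-isCBRB : IsCBRB L _≡_ (λ P _ Q → P ≡ Q)
  ≡-isCBRB = record
    { symR = sym ; symRX = sym
    ; c1a = λ { refl _ step → _ , _ , ε , inj₂ step , refl , refl }
    ; c1b = λ { refl _ → refl }
    ; c2a = λ { refl step → _ , _ , ε , inj₂ step , refl , refl }
    ; c2b = λ { refl _ step → _ , _ , ε , step , refl , refl }
    ; c2c = λ { refl _ → _ , ε , refl }
    ; c2d = λ { refl _ step → _ , _ , ε , step , refl }
    ; c2e = λ { refl stable → _ , ε , stable }
    }

  BrEq-refl : ∀ {P} → BrEq L P P
  BrEq-refl = _ , _ , ≡-isCBRB , refl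

  BrEqX-refl : ∀ {X P} → BrEqX L X P P
  BrEqX-refl = _ , _ , ≡-isCBRB , refl

  BrEq-trans : ∀ {P Q S} → BrEq L P Q → BrEq L Q S → BrEq L P S
  BrEq-trans (_ , _ , isB₁ , r₁) (_ , _ , isB₂ , r₂) =
    _ , _ , ⨾-∪-isCBRB isB₁ isB₂ , inj₁ (_ , r₁ , r₂)

  BrEqX-trans : ∀ {X P Q S} → BrEqX L X P Q → BrEqX L X Q S → BrEqX L X P S
  BrEqX-trans (_ , _ , isB₁ , r₁) (_ , _ , isB₂ , r₂) =
    _ , _ , ⨾-∪-isCBRB isB₁ isB₂ , inj₁ (_ , r₁ , r₂)

  idle-transfer : ∀ {R RX P X Q} → IsRCBRB L R RX → RX P X Q → Idle L X P → Idle L X Q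
  idle-transfer isB r (noX , stable) =
    (λ a a∈X _ step → noX a a∈X _ (proj₁ (proj₂ (r2b (symRX r) a∈X step)))) ,
    (λ _ step → stable _ (proj₁ (proj₂ (r2a (symRX r) step))))
    where open IsRCBRB isB

  module RCBRB-⨾ {R₁ R₂ : BRel} {RX₁ RX₂ : XRel}
                 (isB₁ : IsRCBRB L R₁ RX₁) (isB₂ : IsRCBRB L R₂ RX₂)
                 {T : BRel} {TX : XRel}
                 (ι : R₁ ⨾ R₂ ⇒ T) (ιˣ : ∀ {X} → (RX₁ at X ⨾ RX₂ at X) ⇒ TX at X) where
    module B₁ = IsRCBRB isB₁
    module B₂ = IsRCBRB isB₂

    r1a : ∀ {P Q S α P'} → R₁ P Q → R₂ Q S → InAτ α → P ⟶[ α ] P' →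
          ∃ λ S' → S ⟶[ α ] S' × BrEq L P' S'
    r1a r₁ r₂ α∈Aτ step with B₁.r1a r₁ α∈Aτ step
    ... | _ , answer , e₁ with B₂.r1a r₂ α∈Aτ answer
    ... | S' , answer' , e₂ = S' , answer' , BrEq-trans e₁ e₂

    r1b : ∀ {P Q S} → R₁ P Q → R₂ Q S → ∀ Y → TX P Y S
    r1b r₁ r₂ Y = ιˣ (_ , B₁.r1b r₁ Y , B₂.r1b r₂ Y)

    r2a : ∀ {P X Q S P'} → RX₁ P X Q → RX₂ Q X S → P ⟶[ τ ] P' →
          ∃ λ S' → S ⟶[ τ ] S' × BrEqX L X P' S'
    r2a r₁ r₂ step with B₁.r2a r₁ step
    ... | _ , answer , e₁ with B₂.r2a r₂ answer
    ... | S' , answer' , e₂ = S' , answer' , BrEqX-trans e₁ e₂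

    r2b : ∀ {P X Q S a P'} → RX₁ P X Q → RX₂ Q X S → X a → P ⟶[ act a ] P' →
          ∃ λ S' → S ⟶[ act a ] S' × BrEq L P' S'
    r2b r₁ r₂ a∈X step with B₁.r2b r₁ a∈X step
    ... | _ , answer , e₁ with B₂.r2b r₂ a∈X answer
    ... | S' , answer' , e₂ = S' , answer' , BrEq-trans e₁ e₂

    r2c : ∀ {P X Q S} → RX₁ P X Q → RX₂ Q X S → Idle L X P → T P S
    r2c r₁ r₂ idle = ι (_ , B₁.r2c r₁ idle , B₂.r2c r₂ (idle-transfer isB₁ r₁ idle))

    r2d : ∀ {P X Q S P'} → RX₁ P X Q → RX₂ Q X S → Idle L X P → P ⟶[ t ] P' →
          ∃ λ S' → S ⟶[ t ] S' × BrEqX L X P' S'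
    r2d r₁ r₂ idle step with B₁.r2d r₁ idle step
    ... | _ , answer , e₁ with B₂.r2d r₂ (idle-transfer isB₁ r₁ idle) answer
    ... | S' , answer' , e₂ = S' , answer' , BrEqX-trans e₁ e₂

  ⨾-∪-isRCBRB : ∀ {R₁ R₂ RX₁ RX₂} → IsRCBRB L R₁ RX₁ → IsRCBRB L R₂ RX₂ →
                IsRCBRB L (R₁ ⨾ R₂ ∪ R₂ ⨾ R₁) (RX₁ ⨾ˣ RX₂ ∪ˣ RX₂ ⨾ˣ RX₁)
  ⨾-∪-isRCBRB {R₁} {R₂} {RX₁} {RX₂} isB₁ isB₂ = record
    { symR  = ⨾-∪-symmetric {R₁} {R₂} (IsRCBRB.symR isB₁) (IsRCBRB.symR isB₂)
    ; symRX = λ {_} {X} → ⨾-∪-symmetric {RX₁ at X} {RX₂ at X} (IsRCBRB.symRX isB₁) (IsRCBRB.symRX isB₂)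
    ; r1a = λ { (inj₁ (_ , r₁ , r₂)) → K₁₂.r1a r₁ r₂ ; (inj₂ (_ , r₂ , r₁)) → K₂₁.r1a r₂ r₁ }
    ; r1b = λ { (inj₁ (_ , r₁ , r₂)) → K₁₂.r1b r₁ r₂ ; (inj₂ (_ , r₂ , r₁)) → K₂₁.r1b r₂ r₁ }
    ; r2a = λ { (inj₁ (_ , r₁ , r₂)) → K₁₂.r2a r₁ r₂ ; (inj₂ (_ , r₂ , r₁)) → K₂₁.r2a r₂ r₁ }
    ; r2b = λ { (inj₁ (_ , r₁ , r₂)) → K₁₂.r2b r₁ r₂ ; (inj₂ (_ , r₂ , r₁)) → K₂₁.r2b r₂ r₁ }
    ; r2c = λ { (inj₁ (_ , r₁ , r₂)) → K₁₂.r2c r₁ r₂ ; (inj₂ (_ , r₂ , r₁)) → K₂₁.r2c r₂ r₁ }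
    ; r2d = λ { (inj₁ (_ , r₁ , r₂)) → K₁₂.r2d r₁ r₂ ; (inj₂ (_ , r₂ , r₁)) → K₂₁.r2d r₂ r₁ }
    }
    where
      module K₁₂ = RCBRB-⨾ isB₁ isB₂ inj₁ inj₁
      module K₂₁ = RCBRB-⨾ isB₂ isB₁ inj₂ inj₂

  ≡-isRCBRB : IsRCBRB L _≡_ (λ P _ Q → P ≡ Q)
  ≡-isRCBRB = record
    { symR = sym ; symRX = sym
    ; r1a = λ { refl _ step → _ , step , BrEq-refl }
    ; r1b = λ { refl _ → refl }
    ; r2a = λ { refl step → _ , step , BrEqX-refl }
    ; r2b = λ { refl _ step → _ , step , BrEq-refl }
    ; r2c = λ { refl _ → refl }
    ; r2d = λ { refl _ step → _ , step , BrEqX-refl }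
    }

  RBrEq-isEquivalence : IsEquivalence (RBrEq L)
  RBrEq-isEquivalence = record
    { refl  = _ , _ , ≡-isRCBRB , refl
    ; sym   = λ { (R , RX , isB , r) → R , RX , isB , IsRCBRB.symR isB r }
    ; trans = λ { (_ , _ , isB₁ , r₁) (_ , _ , isB₂ , r₂) →
                  _ , _ , ⨾-∪-isRCBRB isB₁ isB₂ , inj₁ (_ , r₁ , r₂) }
    }

  RBrEqX-isEquivalence : ∀ X → IsEquivalence (RBrEqX L X)
  RBrEqX-isEquivalence X = record
    { refl  = _ , _ , ≡-isRCBRB , refl
    ; sym   = λ { (R , RX , isB , r) → R , RX , isB , IsRCBRB.symRX isB r }
    ; trans = λ { (_ , _ , isB₁ , r₁) (_ , _ , isB₂ , r₂) →
                  _ , _ , ⨾-∪-isRCBRB isB₁ isB₂ , inj₁ (_ , r₁ , r₂) }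
    }

proposition6 : (L : LTS) →
    IsEquivalence (RBrEq L) × (∀ (X : Subset L) → IsEquivalence (RBrEqX L X))
proposition6 L = RBrEq-isEquivalence L , RBrEqX-isEquivalence L
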